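{- Every total function $f:\omega\to\omega$ approximable from above is bounded-Turing equivalent to the characteristic function of some computably enumerable set, and every computably enumerable set (via its characteristic function) is bounded-Turing equivalent to some total function approximable from above.
   Context: A total function is approximable from above if it is $x\mapsto\lim_s g(x,s)$ for a total computable $g$ with $g(x,s+1)\le g(x,s)$. For total $\alpha,\beta:\omega\to\omega$, $\alpha\le_{bT}\beta$ if there are a Turing reduction $\Phi$ using $\beta$ as a function oracle (queried for values $\beta(y)$) and a total computable $b$ such that for each $x$, $\Phi$ computes $\alpha(x)$ querying only values $\beta(y)$ with $y<b(x)$; bounded-Turing equivalence means $\le_{bT}$ in both directions. -}

module Defs where

open import Data.Nat using (ℕ; zero; suc; _≤_; _<_)
open import Data.Fin using (Fin)
open import Data.Vec using (Vec; []; _∷_; lookup)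
open import Data.Bool using (Bool; true; false; if_then_else_)
open import Data.Product using (Σ; ∃; _×_; _,_)
open import Relation.Binary.PropositionalEquality using (_≡_)
open import Function.Bundles using (_⇔_)

-- Codes for n-ary partial recursive (μ-recursive) functions relative to a
-- function oracle (orc = "query the oracle at the argument").
data Code : ℕ → Set where
  zro  : Code 1
  sc   : Code 1
  prj  : ∀ {n} → Fin n → Code n
  orc  : Code 1
  cmp  : ∀ {m n} → Code m → Vec (Code n) m → Code n
  -- h(0,xs) = f xs ; h(y+1,xs) = g(y, h(y,xs), xs)
  prec : ∀ {n} → Code n → Code (suc (suc n)) → Code (suc n)
  -- μ y. f(y,xs) = 0
  mu   : ∀ {n} → Code (suc n) → Code n

-- Big-step semantics relative to oracle α, where every oracle query y
-- must satisfy y < B (the use bound).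
mutual
  data Eval (α : ℕ → ℕ) (B : ℕ) : ∀ {n} → Code n → Vec ℕ n → ℕ → Set where
    ev-zro  : ∀ x → Eval α B zro (x ∷ []) 0
    ev-sc   : ∀ x → Eval α B sc (x ∷ []) (suc x)
    ev-prj  : ∀ {n} (i : Fin n) (xs : Vec ℕ n) → Eval α B (prj i) xs (lookup xs i)
    ev-orc  : ∀ y → y < B → Eval α B orc (y ∷ []) (α y)
    ev-cmp  : ∀ {m n} {f : Code m} {gs : Vec (Code n) m} {xs : Vec ℕ n}
                {ys : Vec ℕ m} {v : ℕ} →
              EvalAll α B gs xs ys → Eval α B f ys v → Eval α B (cmp f gs) xs v
    ev-prec0 : ∀ {n} {f : Code n} {g : Code (suc (suc n))} {xs : Vec ℕ n} {v : ℕ} →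
               Eval α B f xs v → Eval α B (prec f g) (0 ∷ xs) v
    ev-precS : ∀ {n} {f : Code n} {g : Code (suc (suc n))} {xs : Vec ℕ n} {y u v : ℕ} →
               Eval α B (prec f g) (y ∷ xs) u → Eval α B g (y ∷ u ∷ xs) v →
               Eval α B (prec f g) (suc y ∷ xs) v
    ev-mu   : ∀ {n} {f : Code (suc n)} {xs : Vec ℕ n} {y : ℕ} →
              Eval α B f (y ∷ xs) 0 →
              (∀ z → z < y → Σ ℕ λ w → Eval α B f (z ∷ xs) (suc w)) →
              Eval α B (mu f) xs y

  data EvalAll (α : ℕ → ℕ) (B : ℕ) : ∀ {m n} → Vec (Code n) m → Vec ℕ n → Vec ℕ m → Set where
    ea-[] : ∀ {n} {xs : Vec ℕ n} → EvalAll α B [] xs []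
    ea-∷  : ∀ {m n} {g : Code n} {gs : Vec (Code n) m} {xs : Vec ℕ n} {v : ℕ} {vs : Vec ℕ m} →
            Eval α B g xs v → EvalAll α B gs xs vs → EvalAll α B (g ∷ gs) xs (v ∷ vs)

-- Oracle-free evaluation: use bound 0 forbids any oracle query.
EvalPlain : ∀ {n} → Code n → Vec ℕ n → ℕ → Set
EvalPlain c xs v = Eval (λ _ → 0) 0 c xs v

Computable₁ : (ℕ → ℕ) → Set
Computable₁ f = Σ (Code 1) λ c → ∀ x → EvalPlain c (x ∷ []) (f x)

Computable₂ : (ℕ → ℕ → ℕ) → Set
Computable₂ g = Σ (Code 2) λ c → ∀ x s → EvalPlain c (x ∷ s ∷ []) (g x s)

ApproxAbove : (ℕ → ℕ) → Set
ApproxAbove f = Σ (ℕ → ℕ → ℕ) λ g → Computable₂ g ×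
  (∀ x s → g x (suc s) ≤ g x s) ×
  (∀ x → Σ ℕ λ s₀ → ∀ s → s₀ ≤ s → g x s ≡ f x)

_≤bT_ : (ℕ → ℕ) → (ℕ → ℕ) → Set
α ≤bT β = Σ (Code 1) λ Φ → Σ (ℕ → ℕ) λ b → Computable₁ b ×
  (∀ x → Eval β (b x) Φ (x ∷ []) (α x))

_≡bT_ : (ℕ → ℕ) → (ℕ → ℕ) → Set
α ≡bT β = (α ≤bT β) × (β ≤bT α)

χ : (ℕ → Bool) → ℕ → ℕ
χ A x = if A x then 1 else 0

CE : (ℕ → Bool) → Set
CE A = Σ (Code 1) λ c → ∀ x → (A x ≡ true) ⇔ (Σ ℕ λ v → EvalPlain c (x ∷ []) v)

-- If f x = lim_s g x s with g computable and decreasing in s, the strict epigraph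
-- E = {⟨x, m⟩ : f x < m} is c.e.: wait for a stage s with g x s < m. Conversely f x is the least n
-- with ⟨x, n + 1⟩ ∈ E, and it is at most g x 0, so computing f from E only queries below the
-- computable bound ⟨x, g x 0 + 1⟩ + 1; deciding ⟨x, m⟩ ∈ E queries f at x alone.
-- For a c.e. set A, halting of its enumerating code within s steps is decidable uniformly in s,
-- since a clocked interpreter is itself a code; so the characteristic function of the complement of
-- A is the limit of the decreasing guesses "not yet halted at stage s", and it is interreducible
-- with χ A by a single query at x.

module Submission where

open import Defs
open import Data.Nat using (ℕ; zero; suc; _+_; _∸_; _≤_; _<_; _<ᵇ_; _<?_; _⊔_; pred; z≤n; s≤s)
open import Data.Nat.Properties
open import Data.Fin as Fin using (Fin; #_; _↑ʳ_)
open import Data.Vec using (Vec; []; _∷_; lookup; tabulate; map; _++_)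
open import Data.Vec.Properties using (lookup-++ʳ; tabulate-cong; tabulate∘lookup)
open import Data.Bool using (Bool; true; false; not; if_then_else_)
open import Data.Bool.Properties using (T-≡; not-involutive)
open import Data.Product using (Σ; _×_; _,_; proj₁; proj₂)
open import Data.Sum using (_⊎_; inj₁; inj₂; [_,_])
open import Relation.Nullary using (¬_; yes; no; contradiction)
open import Relation.Unary using (Decidable)
open import Relation.Binary.Definitions using (tri<; tri≈; tri>)
open import Relation.Binary.PropositionalEquality using (_≡_; refl; sym; trans; cong; cong₂; subst; module ≡-Reasoning)
open ≡-Reasoning
open import Function.Base using (_∘_)
open import Function.Bundles using (_⇔_; Equivalence; mk⇔)

eval-cast : ∀ {α B n} {c : Code n} {xs v w} → Eval α B c xs v → v ≡ w → Eval α B c xs w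
eval-cast e refl = e

mutual
  eval-deterministic : ∀ {α B n} {c : Code n} {xs v w} → Eval α B c xs v → Eval α B c xs w → v ≡ w
  eval-deterministic (ev-zro x) (ev-zro .x) = refl
  eval-deterministic (ev-sc x) (ev-sc .x) = refl
  eval-deterministic (ev-prj i xs) (ev-prj .i .xs) = refl
  eval-deterministic (ev-orc y _) (ev-orc .y _) = refl
  eval-deterministic (ev-cmp as e) (ev-cmp as′ e′) with evalAll-deterministic as as′
  ... | refl = eval-deterministic e e′
  eval-deterministic (ev-prec0 e) (ev-prec0 e′) = eval-deterministic e e′
  eval-deterministic (ev-precS e₁ e₂) (ev-precS e₁′ e₂′) with eval-deterministic e₁ e₁′
  ... | refl = eval-deterministic e₂ e₂′
  eval-deterministic (ev-mu {y = y} e below) (ev-mu {y = y′} e′ below′) with <-cmp y y′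
  ... | tri< y<y′ _ _ = contradiction (eval-deterministic e (proj₂ (below′ y y<y′))) λ ()
  ... | tri≈ _ y≡y′ _ = y≡y′
  ... | tri> _ _ y′<y = contradiction (eval-deterministic e′ (proj₂ (below y′ y′<y))) λ ()

  evalAll-deterministic : ∀ {α B m n} {cs : Vec (Code n) m} {xs vs ws} →
                          EvalAll α B cs xs vs → EvalAll α B cs xs ws → vs ≡ ws
  evalAll-deterministic ea-[] ea-[] = refl
  evalAll-deterministic (ea-∷ e es) (ea-∷ e′ es′) = cong₂ _∷_ (eval-deterministic e e′) (evalAll-deterministic es es′)

module _ {P : ℕ → Set} (P? : Decidable P) where

  private
    Least : ℕ → Set
    Least y = P y × (∀ z → z < y → ¬ P z)

    least-below : ∀ k → (∀ z → z < k → ¬ P z) ⊎ Σ ℕ Least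
    least-below zero = inj₁ λ _ ()
    least-below (suc k) with least-below k | P? k
    ... | inj₂ found | _ = inj₂ found
    ... | inj₁ none | yes pk = inj₂ (k , pk , none)
    ... | inj₁ none | no ¬pk = inj₁ λ z z<1+k → [ none z , (λ { refl → ¬pk }) ] (m<1+n⇒m<n∨m≡n z<1+k)

  least-witness : ∀ {k} → P k → Σ ℕ λ y → P y × (∀ z → z < y → ¬ P z)
  least-witness {k} pk with least-below (suc k)
  ... | inj₁ none = contradiction pk (none k ≤-refl)
  ... | inj₂ found = found

cmp₁ : ∀ {n} → Code 1 → Code n → Code n
cmp₁ f a = cmp f (a ∷ [])

cmp₂ : ∀ {n} → Code 2 → Code n → Code n → Code n
cmp₂ f a b = cmp f (a ∷ b ∷ [])

-- The nullary zero, needed as base case of a recursion in one variable.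
zero₀ᶜ : Code 0
zero₀ᶜ = mu zro

constᶜ : ∀ {n} → ℕ → Code (suc n)
constᶜ zero = cmp₁ zro (prj (# 0))
constᶜ (suc k) = cmp₁ sc (constᶜ k)

predᶜ : Code 1
predᶜ = prec zero₀ᶜ (prj (# 0))

ifz : ℕ → ℕ → ℕ → ℕ
ifz zero b c = b
ifz (suc _) b c = c

ifzᶜ : ∀ {n} → Code n → Code n → Code n → Code n
ifzᶜ a b c = cmp (prec (prj (# 0)) (prj (# 3))) (a ∷ b ∷ c ∷ [])

iszero : ℕ → ℕ
iszero a = ifz a 1 0

iszeroᶜ : ∀ {n} → Code (suc n) → Code (suc n)
iszeroᶜ a = ifzᶜ a (constᶜ 1) (constᶜ 0)

_+ᶜ_ : ∀ {n} → Code n → Code n → Code n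
a +ᶜ b = cmp₂ (prec (prj (# 0)) (cmp₁ sc (prj (# 1)))) a b

_∸ᶜ_ : ∀ {n} → Code n → Code n → Code n
a ∸ᶜ b = cmp₂ (prec (prj (# 0)) (cmp₁ predᶜ (prj (# 1)))) b a

_<ᶜ_ : ∀ {n} → Code (suc n) → Code (suc n) → Code (suc n)
a <ᶜ b = iszeroᶜ (cmp₁ sc a ∸ᶜ b)

iszero-suc∸ : ∀ u v → iszero (suc u ∸ v) ≡ (if u <ᵇ v then 1 else 0)
iszero-suc∸ u zero = refl
iszero-suc∸ zero (suc v) = cong iszero (0∸n≡0 v)
iszero-suc∸ (suc u) (suc v) = iszero-suc∸ u v

module _ {α : ℕ → ℕ} {B : ℕ} where

  eval-cmp₁ : ∀ {n} {f : Code 1} {a : Code n} {xs u v} →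
              Eval α B a xs u → Eval α B f (u ∷ []) v → Eval α B (cmp₁ f a) xs v
  eval-cmp₁ ea ef = ev-cmp (ea-∷ ea ea-[]) ef

  eval-cmp₂ : ∀ {n} {f : Code 2} {a b : Code n} {xs u u′ v} →
              Eval α B a xs u → Eval α B b xs u′ → Eval α B f (u ∷ u′ ∷ []) v →
              Eval α B (cmp₂ f a b) xs v
  eval-cmp₂ ea eb ef = ev-cmp (ea-∷ ea (ea-∷ eb ea-[])) ef

  eval-zero₀ᶜ : Eval α B zero₀ᶜ [] 0
  eval-zero₀ᶜ = ev-mu (ev-zro 0) (λ _ ())

  eval-constᶜ : ∀ {n} k (xs : Vec ℕ (suc n)) → Eval α B (constᶜ k) xs k
  eval-constᶜ zero (x ∷ xs) = eval-cmp₁ (ev-prj (# 0) (x ∷ xs)) (ev-zro x)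
  eval-constᶜ (suc k) xs = eval-cmp₁ (eval-constᶜ k xs) (ev-sc k)

  eval-predᶜ : ∀ y → Eval α B predᶜ (y ∷ []) (pred y)
  eval-predᶜ zero = ev-prec0 eval-zero₀ᶜ
  eval-predᶜ (suc y) = ev-precS (eval-predᶜ y) (ev-prj (# 0) (y ∷ pred y ∷ []))

  eval-ifzᶜ : ∀ {n} {a b c : Code n} {xs u v w} → Eval α B a xs u → Eval α B b xs v →
              Eval α B c xs w → Eval α B (ifzᶜ a b c) xs (ifz u v w)
  eval-ifzᶜ ea eb ec = ev-cmp (ea-∷ ea (ea-∷ eb (ea-∷ ec ea-[]))) (eval-ifz _ _ _)
    where
    eval-ifz : ∀ a b c → Eval α B (prec (prj (# 0)) (prj (# 3))) (a ∷ b ∷ c ∷ []) (ifz a b c)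
    eval-ifz zero b c = ev-prec0 (ev-prj (# 0) (b ∷ c ∷ []))
    eval-ifz (suc a) b c = ev-precS (eval-ifz a b c) (ev-prj (# 3) (a ∷ ifz a b c ∷ b ∷ c ∷ []))

  eval-iszeroᶜ : ∀ {n} {a : Code (suc n)} {xs u} → Eval α B a xs u → Eval α B (iszeroᶜ a) xs (iszero u)
  eval-iszeroᶜ {xs = xs} ea = eval-ifzᶜ ea (eval-constᶜ 1 xs) (eval-constᶜ 0 xs)

  eval-+ᶜ : ∀ {n} {a b : Code n} {xs u v} → Eval α B a xs u → Eval α B b xs v → Eval α B (a +ᶜ b) xs (u + v)
  eval-+ᶜ ea eb = eval-cmp₂ ea eb (eval-add _ _)
    where
    eval-add : ∀ u v → Eval α B (prec (prj (# 0)) (cmp₁ sc (prj (# 1)))) (u ∷ v ∷ []) (u + v)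
    eval-add zero v = ev-prec0 (ev-prj (# 0) (v ∷ []))
    eval-add (suc u) v = ev-precS (eval-add u v) (eval-cmp₁ (ev-prj (# 1) (u ∷ u + v ∷ v ∷ [])) (ev-sc (u + v)))

  eval-∸ᶜ : ∀ {n} {a b : Code n} {xs u v} → Eval α B a xs u → Eval α B b xs v → Eval α B (a ∸ᶜ b) xs (u ∸ v)
  eval-∸ᶜ ea eb = eval-cmp₂ eb ea (eval-monus _ _)
    where
    eval-monus : ∀ v u → Eval α B (prec (prj (# 0)) (cmp₁ predᶜ (prj (# 1)))) (v ∷ u ∷ []) (u ∸ v)
    eval-monus zero u = ev-prec0 (ev-prj (# 0) (u ∷ []))
    eval-monus (suc v) u = ev-precS (eval-monus v u)
      (eval-cast (eval-cmp₁ (ev-prj (# 1) (v ∷ u ∸ v ∷ u ∷ [])) (eval-predᶜ (u ∸ v))) (pred[m∸n]≡m∸[1+n] u v))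

  eval-<ᶜ : ∀ {n} {a b : Code (suc n)} {xs u v} → Eval α B a xs u → Eval α B b xs v →
            Eval α B (a <ᶜ b) xs (if u <ᵇ v then 1 else 0)
  eval-<ᶜ {u = u} {v} ea eb = eval-cast (eval-iszeroᶜ (eval-∸ᶜ (eval-cmp₁ ea (ev-sc u)) eb)) (iszero-suc∸ u v)

triangle : ℕ → ℕ
triangle zero = 0
triangle (suc k) = triangle k + suc k

triangle-mono-≤ : ∀ {a b} → a ≤ b → triangle a ≤ triangle b
triangle-mono-≤ z≤n = z≤n
triangle-mono-≤ (s≤s a≤b) = +-mono-≤ (triangle-mono-≤ a≤b) (s≤s a≤b)

pair : ℕ → ℕ → ℕ
pair x n = triangle (x + n) + n

pair-monoʳ-≤ : ∀ x {n n′} → n ≤ n′ → pair x n ≤ pair x n′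
pair-monoʳ-≤ x n≤n′ = +-mono-≤ (triangle-mono-≤ (+-monoʳ-≤ x n≤n′)) n≤n′

OnDiagonal : ℕ → ℕ → Set
OnDiagonal t p = triangle t ≤ p × p < triangle (suc t)

onDiagonal-unique : ∀ {t t′ p} → OnDiagonal t p → OnDiagonal t′ p → t ≡ t′
onDiagonal-unique {t} {t′} (lo , hi) (lo′ , hi′) with <-cmp t t′
... | tri< t<t′ _ _ = contradiction (≤-<-trans (≤-trans (triangle-mono-≤ t<t′) lo′) hi) (<-irrefl refl)
... | tri≈ _ t≡t′ _ = t≡t′
... | tri> _ _ t′<t = contradiction (≤-<-trans (≤-trans (triangle-mono-≤ t′<t) lo) hi′) (<-irrefl refl)

diagonal : ℕ → ℕ
diagonal zero = 0
diagonal (suc p) with suc p <? triangle (suc (diagonal p))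
... | yes _ = diagonal p
... | no _ = suc (diagonal p)

onDiagonal-diagonal : ∀ p → OnDiagonal (diagonal p) p
onDiagonal-diagonal zero = z≤n , s≤s z≤n
onDiagonal-diagonal (suc p) with suc p <? triangle (suc (diagonal p)) | onDiagonal-diagonal p
... | yes hi | lo , _ = m≤n⇒m≤1+n lo , hi
... | no ¬hi | _ , hi = ≮⇒≥ ¬hi , ≤-<-trans hi (m<m+n (triangle (suc (diagonal p))) (s≤s z≤n))

unpair₂ : ℕ → ℕ
unpair₂ p = p ∸ triangle (diagonal p)

unpair₁ : ℕ → ℕ
unpair₁ p = diagonal p ∸ unpair₂ p

diagonal-pair : ∀ x n → diagonal (pair x n) ≡ x + n
diagonal-pair x n = onDiagonal-unique (onDiagonal-diagonal (pair x n))
  (m≤m+n (triangle (x + n)) n , +-monoʳ-< (triangle (x + n)) (s≤s (m≤n+m n x)))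

unpair₂-pair : ∀ x n → unpair₂ (pair x n) ≡ n
unpair₂-pair x n = trans (cong (λ t → pair x n ∸ triangle t) (diagonal-pair x n)) (m+n∸m≡n (triangle (x + n)) n)

unpair₁-pair : ∀ x n → unpair₁ (pair x n) ≡ x
unpair₁-pair x n = trans (cong₂ _∸_ (diagonal-pair x n) (unpair₂-pair x n)) (m+n∸n≡m x n)

triangleᶜ : Code 1
triangleᶜ = prec zero₀ᶜ (prj (# 1) +ᶜ cmp₁ sc (prj (# 0)))

-- μ t. p < triangle (t + 1)
diagonalᶜ : Code 1
diagonalᶜ = mu (cmp₁ sc (prj (# 1)) ∸ᶜ cmp₁ triangleᶜ (cmp₁ sc (prj (# 0))))

unpair₂ᶜ : Code 1
unpair₂ᶜ = prj (# 0) ∸ᶜ cmp₁ triangleᶜ diagonalᶜ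

unpair₁ᶜ : Code 1
unpair₁ᶜ = diagonalᶜ ∸ᶜ unpair₂ᶜ

pairᶜ : ∀ {n} → Code n → Code n → Code n
pairᶜ a b = cmp₁ triangleᶜ (a +ᶜ b) +ᶜ b

module _ {α : ℕ → ℕ} {B : ℕ} where

  eval-triangleᶜ : ∀ k → Eval α B triangleᶜ (k ∷ []) (triangle k)
  eval-triangleᶜ zero = ev-prec0 eval-zero₀ᶜ
  eval-triangleᶜ (suc k) = ev-precS (eval-triangleᶜ k)
    (eval-+ᶜ (ev-prj (# 1) (k ∷ triangle k ∷ [])) (eval-cmp₁ (ev-prj (# 0) (k ∷ triangle k ∷ [])) (ev-sc k)))

  eval-diagonalᶜ : ∀ p → Eval α B diagonalᶜ (p ∷ []) (diagonal p)
  eval-diagonalᶜ p = ev-mu (eval-cast (eval-body (diagonal p)) (m≤n⇒m∸n≡0 (proj₂ onDiagonal)))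
    λ z z<t → p ∸ triangle (suc z) ,
              eval-cast (eval-body z) (+-∸-assoc 1 (≤-trans (triangle-mono-≤ z<t) (proj₁ onDiagonal)))
    where
    onDiagonal : OnDiagonal (diagonal p) p
    onDiagonal = onDiagonal-diagonal p
    eval-body : ∀ t → Eval α B (cmp₁ sc (prj (# 1)) ∸ᶜ cmp₁ triangleᶜ (cmp₁ sc (prj (# 0))))
                               (t ∷ p ∷ []) (suc p ∸ triangle (suc t))
    eval-body t = eval-∸ᶜ (eval-cmp₁ (ev-prj (# 1) (t ∷ p ∷ [])) (ev-sc p))
                          (eval-cmp₁ (eval-cmp₁ (ev-prj (# 0) (t ∷ p ∷ [])) (ev-sc t)) (eval-triangleᶜ (suc t)))

  eval-unpair₂ᶜ : ∀ p → Eval α B unpair₂ᶜ (p ∷ []) (unpair₂ p)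
  eval-unpair₂ᶜ p = eval-∸ᶜ (ev-prj (# 0) (p ∷ [])) (eval-cmp₁ (eval-diagonalᶜ p) (eval-triangleᶜ (diagonal p)))

  eval-unpair₁ᶜ : ∀ p → Eval α B unpair₁ᶜ (p ∷ []) (unpair₁ p)
  eval-unpair₁ᶜ p = eval-∸ᶜ (eval-diagonalᶜ p) (eval-unpair₂ᶜ p)

  eval-pairᶜ : ∀ {n} {a b : Code n} {xs u v} → Eval α B a xs u → Eval α B b xs v → Eval α B (pairᶜ a b) xs (pair u v)
  eval-pairᶜ ea eb = eval-+ᶜ (eval-cmp₁ (eval-+ᶜ ea eb) (eval-triangleᶜ _)) eb

stepwise-antitone : ∀ {h : ℕ → ℕ} → (∀ s → h (suc s) ≤ h s) → ∀ {s s′} → s ≤ s′ → h s′ ≤ h s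
stepwise-antitone step {s′ = zero} z≤n = ≤-refl
stepwise-antitone step {s′ = suc s′} s≤1+s′ with m≤n⇒m<n∨m≡n s≤1+s′
... | inj₁ s<1+s′ = ≤-trans (step s′) (stepwise-antitone step (≤-pred s<1+s′))
... | inj₂ refl = ≤-refl

iszero-iszero-pos : ∀ {a} → 0 < a → iszero (iszero a) ≡ 1
iszero-iszero-pos (s≤s _) = refl

module StrictEpigraph {f : ℕ → ℕ} {g : ℕ → ℕ → ℕ} (gᶜ : Code 2)
  (eval-gᶜ : ∀ x s → EvalPlain gᶜ (x ∷ s ∷ []) (g x s))
  (g-step : ∀ x s → g x (suc s) ≤ g x s)
  (g-limit : ∀ x → Σ ℕ λ s₀ → ∀ s → s₀ ≤ s → g x s ≡ f x) where

  f≤g : ∀ x s → f x ≤ g x s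
  f≤g x s = subst (_≤ g x s) (proj₂ (g-limit x) (s₀ ⊔ s) (m≤m⊔n s₀ s)) (stepwise-antitone (g-step x) (m≤n⊔m s₀ s))
    where
    s₀ : ℕ
    s₀ = proj₁ (g-limit x)

  A : ℕ → Bool
  A p = f (unpair₁ p) <ᵇ unpair₂ p

  χA-pair : ∀ x m → χ A (pair x m) ≡ iszero (suc (f x) ∸ m)
  χA-pair x m = trans (cong₂ (λ y n → if f y <ᵇ n then 1 else 0) (unpair₁-pair x m) (unpair₂-pair x m))
                      (sym (iszero-suc∸ (f x) m))

  -- vanishes exactly at the stages s with g x s < m, where p = ⟨x, m⟩
  enumeratorᶜ : Code 2
  enumeratorᶜ = cmp₁ sc (cmp₂ gᶜ (cmp₁ unpair₁ᶜ (prj (# 1))) (prj (# 0))) ∸ᶜ cmp₁ unpair₂ᶜ (prj (# 1))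

  eval-enumeratorᶜ : ∀ s p → EvalPlain enumeratorᶜ (s ∷ p ∷ []) (suc (g (unpair₁ p) s) ∸ unpair₂ p)
  eval-enumeratorᶜ s p = eval-∸ᶜ
    (eval-cmp₁ (eval-cmp₂ (eval-cmp₁ (ev-prj (# 1) (s ∷ p ∷ [])) (eval-unpair₁ᶜ p)) (ev-prj (# 0) (s ∷ p ∷ []))
                          (eval-gᶜ (unpair₁ p) s)) (ev-sc _))
    (eval-cmp₁ (ev-prj (# 1) (s ∷ p ∷ [])) (eval-unpair₂ᶜ p))

  member⇒g-eventually-below : ∀ p → A p ≡ true → Σ ℕ λ s → g (unpair₁ p) s < unpair₂ p
  member⇒g-eventually-below p Ap = s₀ , subst (_< unpair₂ p) (sym (g≡f s₀ ≤-refl)) (<ᵇ⇒< _ _ (Equivalence.from T-≡ Ap))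
    where
    open Σ (g-limit (unpair₁ p)) renaming (proj₁ to s₀; proj₂ to g≡f)

  enumerator-halts : ∀ p → A p ≡ true → Σ ℕ λ v → EvalPlain (mu enumeratorᶜ) (p ∷ []) v
  enumerator-halts p Ap with least-witness (λ s → g (unpair₁ p) s <? unpair₂ p) (proj₂ (member⇒g-eventually-below p Ap))
  ... | s , g<m , earlier = s , ev-mu (eval-cast (eval-enumeratorᶜ s p) (m≤n⇒m∸n≡0 g<m))
    λ z z<s → _ , eval-cast (eval-enumeratorᶜ z p) (+-∸-assoc 1 (≮⇒≥ (earlier z z<s)))

  enumerator-sound : ∀ p → (Σ ℕ λ v → EvalPlain (mu enumeratorᶜ) (p ∷ []) v) → A p ≡ true
  enumerator-sound p (v , ev-mu halt _) = Equivalence.to T-≡ (<⇒<ᵇ (≤-<-trans (f≤g (unpair₁ p) v) g<m))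
    where
    g<m : g (unpair₁ p) v < unpair₂ p
    g<m = m∸n≡0⇒m≤n (eval-deterministic (eval-enumeratorᶜ v p) halt)

  A-ce : CE A
  A-ce = mu enumeratorᶜ , λ p → mk⇔ (enumerator-halts p) (enumerator-sound p)

  -- vanishes first at n = f x, where x is the second argument
  recoverᶜ : Code 2
  recoverᶜ = iszeroᶜ (cmp₁ orc (pairᶜ (prj (# 1)) (cmp₁ sc (prj (# 0)))))

  use : ℕ → ℕ
  use x = suc (pair x (suc (g x 0)))

  eval-recoverᶜ : ∀ {x} n → n ≤ g x 0 →
                  Eval (χ A) (use x) recoverᶜ (n ∷ x ∷ []) (iszero (iszero (f x ∸ n)))
  eval-recoverᶜ {x} n n≤g = eval-cast
    (eval-iszeroᶜ (eval-cmp₁ (eval-pairᶜ (ev-prj (# 1) (n ∷ x ∷ [])) (eval-cmp₁ (ev-prj (# 0) (n ∷ x ∷ [])) (ev-sc n)))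
                             (ev-orc _ (s≤s (pair-monoʳ-≤ x (s≤s n≤g))))))
    (cong iszero (χA-pair x (suc n)))

  f≤bTχA : f ≤bT χ A
  f≤bTχA = mu recoverᶜ , use , useᶜ , λ x →
    ev-mu (eval-cast (eval-recoverᶜ (f x) (f≤g x 0)) (cong (λ d → iszero (iszero d)) (n∸n≡0 (f x))))
          λ z z<fx → 0 , eval-cast (eval-recoverᶜ z (≤-trans (<⇒≤ z<fx) (f≤g x 0))) (iszero-iszero-pos (m<n⇒0<n∸m z<fx))
    where
    useᶜ : Computable₁ use
    useᶜ = cmp₁ sc (pairᶜ (prj (# 0)) (cmp₁ sc (cmp₂ gᶜ (prj (# 0)) (constᶜ 0)))) , λ x →
      eval-cmp₁ (eval-pairᶜ (ev-prj (# 0) (x ∷ []))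
        (eval-cmp₁ (eval-cmp₂ (ev-prj (# 0) (x ∷ [])) (eval-constᶜ 0 (x ∷ [])) (eval-gᶜ x 0)) (ev-sc _))) (ev-sc _)

  χA≤bTf : χ A ≤bT f
  χA≤bTf = cmp₁ orc unpair₁ᶜ <ᶜ unpair₂ᶜ , suc ∘ unpair₁ , (cmp₁ sc unpair₁ᶜ , λ p → eval-cmp₁ (eval-unpair₁ᶜ p) (ev-sc _)) ,
    λ p → eval-<ᶜ (eval-cmp₁ (eval-unpair₁ᶜ p) (ev-orc (unpair₁ p) ≤-refl)) (eval-unpair₂ᶜ p)

approxAbove⇒≡bT-ce : (f : ℕ → ℕ) → ApproxAbove f → Σ (ℕ → Bool) λ A → CE A × (f ≡bT χ A)
approxAbove⇒≡bT-ce f (g , (gᶜ , eval-gᶜ) , g-step , g-limit) = A , A-ce , f≤bTχA , χA≤bTf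
  where open StrictEpigraph gᶜ eval-gᶜ g-step g-limit

-- A clocked value is 0 when no result is reached within the clock, and v + 1 for the result v.
whenDefined : ℕ → ℕ → ℕ
whenDefined a b = ifz a 0 b

allDefined : ∀ {m} → Vec ℕ m → ℕ
allDefined [] = 1
allDefined (r ∷ rs) = whenDefined r (allDefined rs)

primRec : ℕ → (ℕ → ℕ → ℕ) → ℕ → ℕ
primRec b h zero = b
primRec b h (suc y) = h y (primRec b h y)

-- States of an unbounded search through clocked values: 0 when an examined value was undefined,
-- 1 while still searching, y + 2 once the value at y was found to be 0 (clocked value 1).
searchStep : ℕ → ℕ → ℕ → ℕ
searchStep st k r = ifz st 0 (ifz (pred st) (ifz r 0 (ifz (pred r) (suc (suc k)) 1)) st)

searchState : (ℕ → ℕ) → ℕ → ℕ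
searchState h zero = 1
searchState h (suc k) = searchStep (searchState h k) k (h k)

-- All subcomputations share the clock s, each μ-search examines only the candidates below s, and
-- oracle queries never return (plain evaluation has use bound 0).
mutual
  clocked : ∀ {n} → Code n → ℕ → Vec ℕ n → ℕ
  clocked zro s xs = 1
  clocked sc s (x ∷ []) = suc (suc x)
  clocked (prj i) s xs = suc (lookup xs i)
  clocked orc s xs = 0
  clocked (cmp f gs) s xs = whenDefined (allDefined (clockedAll gs s xs)) (clocked f s (map pred (clockedAll gs s xs)))
  clocked (prec f g) s (y ∷ xs) = primRec (clocked f s xs) (clockedRecStep g s xs) y
  clocked (mu f) s xs = pred (searchState (clockedAt f s xs) s)

  clockedAll : ∀ {n m} → Vec (Code n) m → ℕ → Vec ℕ n → Vec ℕ m
  clockedAll [] s xs = []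
  clockedAll (g ∷ gs) s xs = clocked g s xs ∷ clockedAll gs s xs

  clockedRecStep : ∀ {n} → Code (suc (suc n)) → ℕ → Vec ℕ n → ℕ → ℕ → ℕ
  clockedRecStep g s xs y u = whenDefined u (clocked g s (y ∷ pred u ∷ xs))

  clockedAt : ∀ {n} → Code (suc n) → ℕ → Vec ℕ n → ℕ → ℕ
  clockedAt f s xs z = clocked f s (z ∷ xs)

restᶜ : ∀ k {n} → Vec (Code (k + n)) n
restᶜ k = tabulate (λ i → prj (k ↑ʳ i))

allDefinedᶜ : ∀ {n m} → Vec (Code (suc n)) m → Code (suc n)
allDefinedᶜ [] = constᶜ 1
allDefinedᶜ (a ∷ as) = ifzᶜ a (constᶜ 0) (allDefinedᶜ as)

searchStepᶜ : Code 3
searchStepᶜ = ifzᶜ (prj (# 0)) (constᶜ 0)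
  (ifzᶜ (cmp₁ predᶜ (prj (# 0)))
        (ifzᶜ (prj (# 2)) (constᶜ 0) (ifzᶜ (cmp₁ predᶜ (prj (# 2))) (cmp₁ sc (cmp₁ sc (prj (# 1)))) (constᶜ 1)))
        (prj (# 0)))

-- The clock is the first argument of the compiled code.
mutual
  clockedᶜ : ∀ {n} → Code n → Code (suc n)
  clockedᶜ zro = constᶜ 1
  clockedᶜ sc = cmp₁ sc (cmp₁ sc (prj (# 1)))
  clockedᶜ (prj i) = cmp₁ sc (prj (Fin.suc i))
  clockedᶜ orc = constᶜ 0
  clockedᶜ (cmp f gs) = ifzᶜ (allDefinedᶜ (clockedAllᶜ gs)) (constᶜ 0)
                             (cmp (clockedᶜ f) (prj (# 0) ∷ map (cmp₁ predᶜ) (clockedAllᶜ gs)))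
  clockedᶜ (prec f g) = cmp (prec (clockedᶜ f) (clockedRecStepᶜ g)) (prj (# 1) ∷ prj (# 0) ∷ restᶜ 2)
  clockedᶜ (mu f) = cmp₁ predᶜ (cmp (prec (constᶜ 1) (searchStepAtᶜ f)) (prj (# 0) ∷ prj (# 0) ∷ restᶜ 1))

  clockedAllᶜ : ∀ {n m} → Vec (Code n) m → Vec (Code (suc n)) m
  clockedAllᶜ [] = []
  clockedAllᶜ (g ∷ gs) = clockedᶜ g ∷ clockedAllᶜ gs

  clockedRecStepᶜ : ∀ {n} → Code (suc (suc n)) → Code (suc (suc (suc n)))
  clockedRecStepᶜ g = ifzᶜ (prj (# 1)) (constᶜ 0)
    (cmp (clockedᶜ g) (prj (# 2) ∷ prj (# 0) ∷ cmp₁ predᶜ (prj (# 1)) ∷ restᶜ 3))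

  searchStepAtᶜ : ∀ {n} → Code (suc n) → Code (suc (suc (suc n)))
  searchStepAtᶜ f = cmp searchStepᶜ (prj (# 1) ∷ prj (# 0) ∷ cmp (clockedᶜ f) (prj (# 2) ∷ prj (# 0) ∷ restᶜ 3) ∷ [])

module _ {α : ℕ → ℕ} {B : ℕ} where

  evalAll-prjs : ∀ {n m} (F : Fin n → Fin m) (zs : Vec ℕ m) →
                 EvalAll α B (tabulate (λ i → prj (F i))) zs (tabulate (λ i → lookup zs (F i)))
  evalAll-prjs {zero} F zs = ea-[]
  evalAll-prjs {suc n} F zs = ea-∷ (ev-prj (F Fin.zero) zs) (evalAll-prjs (F ∘ Fin.suc) zs)

  evalAll-restᶜ : ∀ {k n} (ys : Vec ℕ k) (xs : Vec ℕ n) → EvalAll α B (restᶜ k) (ys ++ xs) xs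
  evalAll-restᶜ {k} ys xs = subst (EvalAll α B (restᶜ k) (ys ++ xs))
    (trans (tabulate-cong (lookup-++ʳ ys xs)) (tabulate∘lookup xs)) (evalAll-prjs (k ↑ʳ_) (ys ++ xs))

  eval-allDefinedᶜ : ∀ {n m} {as : Vec (Code (suc n)) m} {zs vs} → EvalAll α B as zs vs →
                     Eval α B (allDefinedᶜ as) zs (allDefined vs)
  eval-allDefinedᶜ {zs = zs} ea-[] = eval-constᶜ 1 zs
  eval-allDefinedᶜ {zs = zs} (ea-∷ e es) = eval-ifzᶜ e (eval-constᶜ 0 zs) (eval-allDefinedᶜ es)

  evalAll-preds : ∀ {n m} {as : Vec (Code n) m} {zs vs} → EvalAll α B as zs vs →
                  EvalAll α B (map (cmp₁ predᶜ) as) zs (map pred vs)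
  evalAll-preds ea-[] = ea-[]
  evalAll-preds (ea-∷ e es) = ea-∷ (eval-cmp₁ e (eval-predᶜ _)) (evalAll-preds es)

  eval-searchStepᶜ : ∀ st k r → Eval α B searchStepᶜ (st ∷ k ∷ r ∷ []) (searchStep st k r)
  eval-searchStepᶜ st k r =
    eval-ifzᶜ (ev-prj (# 0) xs) (eval-constᶜ 0 xs)
      (eval-ifzᶜ (eval-cmp₁ (ev-prj (# 0) xs) (eval-predᶜ st))
        (eval-ifzᶜ (ev-prj (# 2) xs) (eval-constᶜ 0 xs)
          (eval-ifzᶜ (eval-cmp₁ (ev-prj (# 2) xs) (eval-predᶜ r))
            (eval-cmp₁ (eval-cmp₁ (ev-prj (# 1) xs) (ev-sc k)) (ev-sc _)) (eval-constᶜ 1 xs)))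
        (ev-prj (# 0) xs))
    where
    xs : Vec ℕ 3
    xs = st ∷ k ∷ r ∷ []

  mutual
    eval-clockedᶜ : ∀ {n} (c : Code n) s xs → Eval α B (clockedᶜ c) (s ∷ xs) (clocked c s xs)
    eval-clockedᶜ zro s xs = eval-constᶜ 1 _
    eval-clockedᶜ sc s (x ∷ []) = eval-cmp₁ (eval-cmp₁ (ev-prj (# 1) (s ∷ x ∷ [])) (ev-sc x)) (ev-sc _)
    eval-clockedᶜ (prj i) s xs = eval-cmp₁ (ev-prj (Fin.suc i) (s ∷ xs)) (ev-sc _)
    eval-clockedᶜ orc s xs = eval-constᶜ 0 _
    eval-clockedᶜ (cmp f gs) s xs = eval-ifzᶜ (eval-allDefinedᶜ (evalAll-clockedAllᶜ gs s xs)) (eval-constᶜ 0 _)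
      (ev-cmp (ea-∷ (ev-prj (# 0) (s ∷ xs)) (evalAll-preds (evalAll-clockedAllᶜ gs s xs)))
              (eval-clockedᶜ f s (map pred (clockedAll gs s xs))))
    eval-clockedᶜ (prec f g) s (y ∷ xs) =
      ev-cmp (ea-∷ (ev-prj (# 1) _) (ea-∷ (ev-prj (# 0) _) (evalAll-restᶜ (s ∷ y ∷ []) xs))) (eval-clockedRec f g s xs y)
    eval-clockedᶜ (mu f) s xs = eval-cmp₁
      (ev-cmp (ea-∷ (ev-prj (# 0) (s ∷ xs)) (ea-∷ (ev-prj (# 0) (s ∷ xs)) (evalAll-restᶜ (s ∷ []) xs))) (eval-search f s xs s))
      (eval-predᶜ _)

    evalAll-clockedAllᶜ : ∀ {n m} (gs : Vec (Code n) m) s xs → EvalAll α B (clockedAllᶜ gs) (s ∷ xs) (clockedAll gs s xs)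
    evalAll-clockedAllᶜ [] s xs = ea-[]
    evalAll-clockedAllᶜ (g ∷ gs) s xs = ea-∷ (eval-clockedᶜ g s xs) (evalAll-clockedAllᶜ gs s xs)

    eval-clockedRec : ∀ {n} (f : Code n) g s xs y →
                      Eval α B (prec (clockedᶜ f) (clockedRecStepᶜ g)) (y ∷ s ∷ xs) (primRec (clocked f s xs) (clockedRecStep g s xs) y)
    eval-clockedRec f g s xs zero = ev-prec0 (eval-clockedᶜ f s xs)
    eval-clockedRec f g s xs (suc y) = ev-precS (eval-clockedRec f g s xs y)
      (eval-ifzᶜ (ev-prj (# 1) zs) (eval-constᶜ 0 zs)
        (ev-cmp (ea-∷ (ev-prj (# 2) zs) (ea-∷ (ev-prj (# 0) zs)
                  (ea-∷ (eval-cmp₁ (ev-prj (# 1) zs) (eval-predᶜ u)) (evalAll-restᶜ (y ∷ u ∷ s ∷ []) xs))))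
                (eval-clockedᶜ g s (y ∷ pred u ∷ xs))))
      where
      u : ℕ
      u = primRec (clocked f s xs) (clockedRecStep g s xs) y
      zs : Vec ℕ _
      zs = y ∷ u ∷ s ∷ xs

    eval-search : ∀ {n} (f : Code (suc n)) s xs k →
                  Eval α B (prec (constᶜ 1) (searchStepAtᶜ f)) (k ∷ s ∷ xs) (searchState (clockedAt f s xs) k)
    eval-search f s xs zero = ev-prec0 (eval-constᶜ 1 (s ∷ xs))
    eval-search f s xs (suc k) = ev-precS (eval-search f s xs k)
      (ev-cmp (ea-∷ (ev-prj (# 1) zs) (ea-∷ (ev-prj (# 0) zs)
                (ea-∷ (ev-cmp (ea-∷ (ev-prj (# 2) zs) (ea-∷ (ev-prj (# 0) zs) (evalAll-restᶜ (k ∷ st ∷ s ∷ []) xs)))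
                              (eval-clockedᶜ f s (k ∷ xs))) ea-[])))
              (eval-searchStepᶜ st k _))
      where
      st : ℕ
      st = searchState (clockedAt f s xs) k
      zs : Vec ℕ _
      zs = k ∷ st ∷ s ∷ xs

whenDefined-defined : ∀ a b {v} → whenDefined a b ≡ suc v → Σ ℕ λ w → a ≡ suc w
whenDefined-defined (suc a) b _ = a , refl

whenDefined-value : ∀ a b {v} → whenDefined a b ≡ suc v → b ≡ suc v
whenDefined-value (suc a) b e = e

pred≡suc : ∀ a {v} → pred a ≡ suc v → a ≡ suc (suc v)
pred≡suc (suc (suc a)) refl = refl

NonzeroBelow : (ℕ → ℕ) → ℕ → Set
NonzeroBelow h y = ∀ z → z < y → Σ ℕ λ w → h z ≡ suc (suc w)

searchStep≡1 : ∀ st k r → searchStep st k r ≡ 1 → st ≡ 1 × Σ ℕ λ w → r ≡ suc (suc w)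
searchStep≡1 (suc zero) k (suc (suc w)) _ = refl , w , refl

searchStep-found : ∀ st k r {y} → searchStep st k r ≡ suc (suc y) →
                   st ≡ suc (suc y) ⊎ (st ≡ 1 × r ≡ 1 × y ≡ k)
searchStep-found (suc zero) k (suc zero) refl = inj₂ (refl , refl , refl)
searchStep-found (suc (suc st)) k r refl = inj₁ refl

searchState≡1⇒nonzeroBelow : ∀ h k → searchState h k ≡ 1 → NonzeroBelow h k
searchState≡1⇒nonzeroBelow h (suc k) e z z<1+k with searchStep≡1 _ k (h k) e | m<1+n⇒m<n∨m≡n z<1+k
... | st≡1 , _ | inj₁ z<k = searchState≡1⇒nonzeroBelow h k st≡1 z z<k
... | _ , hk≢0 | inj₂ refl = hk≢0

nonzeroBelow⇒searchState≡1 : ∀ h k → NonzeroBelow h k → searchState h k ≡ 1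
nonzeroBelow⇒searchState≡1 h zero _ = refl
nonzeroBelow⇒searchState≡1 h (suc k) below =
  cong₂ (λ st r → searchStep st k r) (nonzeroBelow⇒searchState≡1 h k (λ z z<k → below z (m<n⇒m<1+n z<k)))
                                     (proj₂ (below k ≤-refl))

searchState-found : ∀ h k {y} → searchState h k ≡ suc (suc y) → y < k × h y ≡ 1 × NonzeroBelow h y
searchState-found h (suc k) e with searchStep-found _ k (h k) e
... | inj₁ st≡y+2 = let y<k , hy , below = searchState-found h k st≡y+2 in m<n⇒m<1+n y<k , hy , below
... | inj₂ (st≡1 , hk≡1 , refl) = ≤-refl , hk≡1 , searchState≡1⇒nonzeroBelow h k st≡1

searchState-finds : ∀ h {y} → h y ≡ 1 → NonzeroBelow h y → ∀ {k} → y < k → searchState h k ≡ suc (suc y)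
searchState-finds h {y} hy below {suc k} y<1+k with m<1+n⇒m<n∨m≡n y<1+k
... | inj₁ y<k = cong (λ st → searchStep st k (h k)) (searchState-finds h hy below y<k)
... | inj₂ refl = cong₂ (λ st r → searchStep st y r) (nonzeroBelow⇒searchState≡1 h y below) hy

mutual
  clocked-sound : ∀ {n} (c : Code n) s xs {v} → clocked c s xs ≡ suc v → EvalPlain c xs v
  clocked-sound zro s (x ∷ []) refl = ev-zro x
  clocked-sound sc s (x ∷ []) refl = ev-sc x
  clocked-sound (prj i) s xs refl = ev-prj i xs
  clocked-sound (cmp f gs) s xs e =
    ev-cmp (clockedAll-sound gs s xs (proj₂ (whenDefined-defined _ _ e))) (clocked-sound f s _ (whenDefined-value _ _ e))
  clocked-sound (prec f g) s (y ∷ xs) e = clockedRec-sound f g s xs y e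
  clocked-sound (mu f) s xs e with searchState-found (clockedAt f s xs) s (pred≡suc _ e)
  ... | _ , fy≡1 , below = ev-mu (clocked-sound f s _ fy≡1) λ z z<y → proj₁ (below z z<y) , clocked-sound f s _ (proj₂ (below z z<y))

  clockedAll-sound : ∀ {n m} (gs : Vec (Code n) m) s xs {w} → allDefined (clockedAll gs s xs) ≡ suc w →
                     EvalAll (λ _ → 0) 0 gs xs (map pred (clockedAll gs s xs))
  clockedAll-sound [] s xs e = ea-[]
  clockedAll-sound (g ∷ gs) s xs e with whenDefined-defined (clocked g s xs) _ e
  ... | w , g≡1+w = ea-∷ (eval-cast (clocked-sound g s xs g≡1+w) (sym (cong pred g≡1+w)))
                         (clockedAll-sound gs s xs (whenDefined-value _ _ e))

  clockedRec-sound : ∀ {n} (f : Code n) g s xs y {v} → primRec (clocked f s xs) (clockedRecStep g s xs) y ≡ suc v →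
                     EvalPlain (prec f g) (y ∷ xs) v
  clockedRec-sound f g s xs zero e = ev-prec0 (clocked-sound f s xs e)
  clockedRec-sound f g s xs (suc y) {v} e with whenDefined-defined (primRec (clocked f s xs) (clockedRecStep g s xs) y) _ e
  ... | u , rec≡1+u = ev-precS (clockedRec-sound f g s xs y rec≡1+u)
    (clocked-sound g s (y ∷ u ∷ xs) (subst (λ t → clocked g s (y ∷ pred t ∷ xs) ≡ suc v) rec≡1+u (whenDefined-value _ _ e)))

mutual
  clocked-mono : ∀ {n} (c : Code n) {s s′} xs {v} → s ≤ s′ → clocked c s xs ≡ suc v → clocked c s′ xs ≡ suc v
  clocked-mono zro xs s≤s′ e = e
  clocked-mono sc (x ∷ []) s≤s′ e = e
  clocked-mono (prj i) xs s≤s′ e = e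
  clocked-mono (cmp f gs) {s} {s′} xs s≤s′ e with whenDefined-defined _ _ e
  ... | _ , all≡1+w rewrite clockedAll-mono gs xs s≤s′ all≡1+w | all≡1+w = clocked-mono f _ s≤s′ e
  clocked-mono (prec f g) (y ∷ xs) s≤s′ e = clockedRec-mono f g xs y s≤s′ e
  clocked-mono (mu f) {s} {s′} xs s≤s′ e with searchState-found (clockedAt f s xs) s (pred≡suc _ e)
  ... | y<s , fy≡1 , below = cong pred (searchState-finds (clockedAt f s′ xs) (clocked-mono f _ s≤s′ fy≡1)
          (λ z z<y → proj₁ (below z z<y) , clocked-mono f _ s≤s′ (proj₂ (below z z<y))) (≤-trans y<s s≤s′))

  clockedAll-mono : ∀ {n m} (gs : Vec (Code n) m) {s s′} xs {w} → s ≤ s′ → allDefined (clockedAll gs s xs) ≡ suc w →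
                    clockedAll gs s′ xs ≡ clockedAll gs s xs
  clockedAll-mono [] xs s≤s′ e = refl
  clockedAll-mono (g ∷ gs) {s} xs s≤s′ e with whenDefined-defined (clocked g s xs) _ e
  ... | _ , g≡1+w = cong₂ _∷_ (trans (clocked-mono g xs s≤s′ g≡1+w) (sym g≡1+w))
                              (clockedAll-mono gs xs s≤s′ (whenDefined-value _ _ e))

  clockedRec-mono : ∀ {n} (f : Code n) g {s s′} xs y {v} → s ≤ s′ →
                    primRec (clocked f s xs) (clockedRecStep g s xs) y ≡ suc v →
                    primRec (clocked f s′ xs) (clockedRecStep g s′ xs) y ≡ suc v
  clockedRec-mono f g xs zero s≤s′ e = clocked-mono f xs s≤s′ e
  clockedRec-mono f g {s} {s′} xs (suc y) {v} s≤s′ e with whenDefined-defined (primRec (clocked f s xs) (clockedRecStep g s xs) y) _ e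
  ... | u , rec≡1+u rewrite clockedRec-mono f g xs y s≤s′ rec≡1+u | rec≡1+u = clocked-mono g _ s≤s′ e

common-clock : ∀ {P : ℕ → ℕ → Set} → (∀ {z s s′} → s ≤ s′ → P z s → P z s′) →
               ∀ y → (∀ z → z < y → Σ ℕ (P z)) → Σ ℕ λ S → ∀ z → z < y → P z S
common-clock mono zero _ = 0 , λ _ ()
common-clock mono (suc y) each with common-clock mono y (λ z z<y → each z (m<n⇒m<1+n z<y)) | each y ≤-refl
... | S , below | s , at-y = S ⊔ s , λ z z<1+y →
  [ (λ z<y → mono (m≤m⊔n S s) (below z z<y)) , (λ { refl → mono (m≤n⊔m S s) at-y }) ] (m<1+n⇒m<n∨m≡n z<1+y)

allDefined-suc : ∀ {m} (vs : Vec ℕ m) → allDefined (map suc vs) ≡ 1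
allDefined-suc [] = refl
allDefined-suc (v ∷ vs) = allDefined-suc vs

map-pred-suc : ∀ {m} (vs : Vec ℕ m) → map pred (map suc vs) ≡ vs
map-pred-suc [] = refl
map-pred-suc (v ∷ vs) = cong (v ∷_) (map-pred-suc vs)

mutual
  clocked-complete : ∀ {n} {c : Code n} {xs v} → EvalPlain c xs v → Σ ℕ λ s → clocked c s xs ≡ suc v
  clocked-complete (ev-zro x) = 0 , refl
  clocked-complete (ev-sc x) = 0 , refl
  clocked-complete (ev-prj i xs) = 0 , refl
  clocked-complete (ev-cmp {f = f} {gs = gs} {xs = xs} {ys = ys} es e)
    with clockedAll-complete es | clocked-complete e
  ... | s₁ , gs≡ | s₂ , f≡ = s₁ ⊔ s₂ ,
    (begin
      whenDefined (allDefined (clockedAll gs (s₁ ⊔ s₂) xs)) (clocked f (s₁ ⊔ s₂) (map pred (clockedAll gs (s₁ ⊔ s₂) xs)))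
        ≡⟨ cong (λ R → whenDefined (allDefined R) (clocked f (s₁ ⊔ s₂) (map pred R))) gs≡′ ⟩
      whenDefined (allDefined (map suc ys)) (clocked f (s₁ ⊔ s₂) (map pred (map suc ys)))
        ≡⟨ cong₂ whenDefined (allDefined-suc ys) (cong (clocked f (s₁ ⊔ s₂)) (map-pred-suc ys)) ⟩
      clocked f (s₁ ⊔ s₂) ys
        ≡⟨ clocked-mono f ys (m≤n⊔m s₁ s₂) f≡ ⟩
      _ ∎)
    where
    gs≡′ : clockedAll gs (s₁ ⊔ s₂) xs ≡ map suc ys
    gs≡′ = trans (clockedAll-mono gs xs (m≤m⊔n s₁ s₂) (trans (cong allDefined gs≡) (allDefined-suc ys))) gs≡
  clocked-complete (ev-prec0 e) = clocked-complete e
  clocked-complete (ev-precS {f = f} {g = g} {xs = xs} {y = y} {u = u} e₁ e₂)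
    with clocked-complete e₁ | clocked-complete e₂
  ... | s₁ , rec≡ | s₂ , g≡ = s₁ ⊔ s₂ ,
    trans (cong (λ t → whenDefined t (clocked g (s₁ ⊔ s₂) (y ∷ pred t ∷ xs)))
                (clocked-mono (prec f g) (y ∷ xs) (m≤m⊔n s₁ s₂) rec≡))
          (clocked-mono g (y ∷ u ∷ xs) (m≤n⊔m s₁ s₂) g≡)
  clocked-complete (ev-mu {f = f} {xs = xs} {y = y} e below)
    with clocked-complete e
       | common-clock (λ s≤s′ (w , f≡) → w , clocked-mono f _ s≤s′ f≡) y (λ z z<y → clocked-complete-nonzero (below z z<y))
  ... | s₀ , fy≡1 | S , below≡ = t , cong pred (searchState-finds (clockedAt f t xs)
      (clocked-mono f _ (≤-trans (m≤m⊔n s₀ S) t≥s₀⊔S) fy≡1)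
      (λ z z<y → let w , f≡ = below≡ z z<y in w , clocked-mono f _ (≤-trans (m≤n⊔m s₀ S) t≥s₀⊔S) f≡)
      (m≤m⊔n (suc y) (s₀ ⊔ S)))
    where
    t : ℕ
    t = suc y ⊔ (s₀ ⊔ S)
    t≥s₀⊔S : s₀ ⊔ S ≤ t
    t≥s₀⊔S = m≤n⊔m (suc y) (s₀ ⊔ S)

  clocked-complete-nonzero : ∀ {n} {c : Code (suc n)} {z xs} → (Σ ℕ λ w → EvalPlain c (z ∷ xs) (suc w)) →
                             Σ ℕ λ s → Σ ℕ λ w → clocked c s (z ∷ xs) ≡ suc (suc w)
  clocked-complete-nonzero (w , e) = let s , c≡ = clocked-complete e in s , w , c≡

  clockedAll-complete : ∀ {n m} {gs : Vec (Code n) m} {xs vs} → EvalAll (λ _ → 0) 0 gs xs vs →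
                        Σ ℕ λ s → clockedAll gs s xs ≡ map suc vs
  clockedAll-complete ea-[] = 0 , refl
  clockedAll-complete (ea-∷ {g = g} {gs = gs} {xs = xs} {vs = vs} e es) with clocked-complete e | clockedAll-complete es
  ... | s₁ , g≡ | s₂ , gs≡ = s₁ ⊔ s₂ , cong₂ _∷_ (clocked-mono g xs (m≤m⊔n s₁ s₂) g≡)
        (trans (clockedAll-mono gs xs (m≤n⊔m s₁ s₂) (trans (cong allDefined gs≡) (allDefined-suc vs))) gs≡)

iszero-χ : ∀ b → iszero (if b then 1 else 0) ≡ (if not b then 1 else 0)
iszero-χ true = refl
iszero-χ false = refl

complement-≤bT : ∀ {A C : ℕ → Bool} → (∀ x → C x ≡ not (A x)) → χ C ≤bT χ A
complement-≤bT {A} C≡¬A = iszeroᶜ orc , suc , (sc , ev-sc) , λ x →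
  eval-cast (eval-iszeroᶜ (ev-orc x ≤-refl)) (trans (iszero-χ (A x)) (cong (λ b → if b then 1 else 0) (sym (C≡¬A x))))

iszero-antitone : ∀ a b → (∀ {v} → a ≡ suc v → b ≡ suc v) → iszero b ≤ iszero a
iszero-antitone zero zero _ = ≤-refl
iszero-antitone zero (suc b) _ = z≤n
iszero-antitone (suc a) b a⇒b rewrite a⇒b refl = ≤-refl

module ComplementApproximation {A : ℕ → Bool} (c : Code 1)
  (c-halts : ∀ x → (A x ≡ true) ⇔ (Σ ℕ λ v → EvalPlain c (x ∷ []) v)) where

  g : ℕ → ℕ → ℕ
  g x s = iszero (clocked c s (x ∷ []))

  g-computable : Computable₂ g
  g-computable = iszeroᶜ (cmp (clockedᶜ c) (prj (# 1) ∷ prj (# 0) ∷ [])) , λ x s →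
    eval-iszeroᶜ (ev-cmp (ea-∷ (ev-prj (# 1) _) (ea-∷ (ev-prj (# 0) _) ea-[])) (eval-clockedᶜ c s (x ∷ [])))

  g-step : ∀ x s → g x (suc s) ≤ g x s
  g-step x s = iszero-antitone _ _ (clocked-mono c _ (n≤1+n s))

  g-limit : ∀ x → Σ ℕ λ s₀ → ∀ s → s₀ ≤ s → g x s ≡ χ (not ∘ A) x
  g-limit x with A x in Ax
  ... | true = let _ , halts = Equivalence.to (c-halts x) Ax ; s₀ , c≡ = clocked-complete halts in
    s₀ , λ s s₀≤s → cong iszero (clocked-mono c _ s₀≤s c≡)
  ... | false = 0 , λ s _ → cong iszero (never-defined s)
    where
    never-defined : ∀ s → clocked c s (x ∷ []) ≡ 0
    never-defined s with clocked c s (x ∷ []) in c≡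
    ... | zero = refl
    ... | suc v = contradiction (trans (sym (Equivalence.from (c-halts x) (v , clocked-sound c s _ c≡))) Ax) λ ()

ce⇒≡bT-approxAbove : (A : ℕ → Bool) → CE A → Σ (ℕ → ℕ) λ f → ApproxAbove f × (χ A ≡bT f)
ce⇒≡bT-approxAbove A (c , c-halts) =
  χ (not ∘ A) , (g , g-computable , g-step , g-limit) ,
  complement-≤bT (λ x → sym (not-involutive (A x))) , complement-≤bT (λ _ → refl)
  where open ComplementApproximation c c-halts

proposition3p13 : ((f : ℕ → ℕ) → ApproxAbove f → Σ (ℕ → Bool) λ A → CE A × (f ≡bT χ A)) ×
    ((A : ℕ → Bool) → CE A → Σ (ℕ → ℕ) λ f → ApproxAbove f × (χ A ≡bT f))
proposition3p13 = approxAbove⇒≡bT-ce , ce⇒≡bT-approxAbove
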